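{- Let $p$ be a prime, $K$ a finite extension of $\mathbb{Q}_p$ with maximal ideal $\mathfrak{p}$ of $\mathcal{O}_K$. Let $x \in K$ be nonzero with $\nu_{\mathfrak{p}}(x) = bp^{k}$ where $b \in \mathbb{Q}$, $\nu_p(b) = 0$ and $k > 0$ is an integer. Let $k' := ((k-1) \bmod p) + 1 \leq p$. Then the first $k'$ terms of the $\mathrm{inc}_{\mathfrak{p}}$ sequence of $x$ are \[(k-1, \underbrace{ -1, -1, \ldots, -1}_{(k-1 \bmod p) \text{ copies}}),\] i.e. $\nu_{\mathfrak{p}}(D_{K,\mathfrak{p}}(x)) - \nu_{\mathfrak{p}}(x) = k-1$ and $\nu_{\mathfrak{p}}(D^{j+1}_{K,\mathfrak{p}}(x)) - \nu_{\mathfrak{p}}(D^{j}_{K,\mathfrak{p}}(x)) = -1$ for $1 \le j \le k'-1$.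
   Context: $\nu_{\mathfrak{p}}$ is the unique discrete valuation on $K$ extending the $p$-adic valuation $\nu_p$ (so $\nu_{\mathfrak{p}}(p)=1$). $D_{K,\mathfrak{p}}(x) = x\,\nu_{\mathfrak{p}}(x)/p$ for $x\neq 0$, $D_{K,\mathfrak{p}}(0)=0$; $D^i_{K,\mathfrak{p}}$ is the $i$-th iterate. The $\mathrm{inc}_{\mathfrak{p}}$ sequence of $x$ is the sequence of increments $\nu_{\mathfrak{p}}(D^{i+1}_{K,\mathfrak{p}}(x)) - \nu_{\mathfrak{p}}(D^{i}_{K,\mathfrak{p}}(x))$, $i=0,1,2,\ldots$. For an integer $m$, $m \bmod p$ denotes the least nonnegative residue of $m$ modulo $p$. -}

module Defs where

open import Level using (Level; suc; _⊔_)
open import Data.Nat as ℕ using (ℕ; NonZero; _^_)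
open import Data.Nat.Divisibility using (_∣_)
open import Data.Integer as ℤ using (ℤ; +_; ∣_∣)
open import Data.Rational as ℚ using (ℚ; 0ℚ; 1ℚ; _/_; ↥_; ↧ₙ_)
open import Data.Product using (Σ; _×_)
open import Relation.Nullary using (¬_)
open import Relation.Binary.PropositionalEquality using (_≡_)
open import Algebra.Bundles using (CommutativeRing)

ℕ→ℚ : ℕ → ℚ
ℕ→ℚ n = (+ n) / 1

-- ν_p(b) = 0 for a rational b (written in lowest terms):
-- p divides neither the numerator nor the denominator (in particular b ≠ 0)
PadicUnit : ℕ → ℚ → Set
PadicUnit p b = ¬ (p ∣ ∣ ↥ b ∣) × ¬ (p ∣ ↧ₙ b)

-- An abstract valued field K ⊇ ℚ (characteristic 0) with a discrete valuation
-- ν : K → ℚ extending the p-adic valuation ν_p of ℚ (normalised by ν(p) = 1).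
-- The value ν(0) (= ∞ in the paper) is junk and is never used.
record PValuedField (p : ℕ) (c ℓ : Level) : Set (suc (c ⊔ ℓ)) where
  field
    K-ring : CommutativeRing c ℓ
  open CommutativeRing K-ring public
  field
    1≉0     : ¬ (1# ≈ 0#)
    inverse : ∀ x → ¬ (x ≈ 0#) → Σ Carrier (λ y → (x * y) ≈ 1#)
    ι       : ℚ → Carrier
    ι-1 : ι 1ℚ ≈ 1#
    ι-+     : ∀ q r → ι (q ℚ.+ r) ≈ (ι q + ι r)
    ι-*     : ∀ q r → ι (q ℚ.* r) ≈ (ι q * ι r)
    ν       : Carrier → ℚ
    ν-cong  : ∀ {x y} → x ≈ y → ν x ≡ ν y
    ν-*     : ∀ x y → ¬ (x ≈ 0#) → ¬ (y ≈ 0#) → ν (x * y) ≡ ν x ℚ.+ ν y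
    ν-+     : ∀ x y → ¬ (x ≈ 0#) → ¬ (y ≈ 0#) → ¬ ((x + y) ≈ 0#) →
              (ν x ℚ.⊓ ν y) ℚ.≤ ν (x + y)
    e       : ℕ
    e-pos   : ¬ (e ≡ 0)
    ν-disc  : ∀ x → ¬ (x ≈ 0#) → Σ ℤ (λ z → ν x ℚ.* ℕ→ℚ e ≡ (z / 1))
    ν-p     : ν (ι (ℕ→ℚ p)) ≡ 1ℚ
    ν-unit  : ∀ u → PadicUnit p u → ν (ι u) ≡ 0ℚ

module _ {p : ℕ} .{{_ : NonZero p}} {c ℓ : Level} (K : PValuedField p c ℓ) where
  open PValuedField K

  -- D_{K,𝔭}(x) = x · ν(x)/p   (this gives 0 at x = 0 whatever the junk ν(0) is)
  D : Carrier → Carrier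
  D x = x * ι (ν x ℚ.* ((+ 1) / p))

  Dⁱ : ℕ → Carrier → Carrier
  Dⁱ ℕ.zero    x = x
  Dⁱ (ℕ.suc i) x = D (Dⁱ i x)

  inc : Carrier → ℕ → ℚ
  inc x i = ν (Dⁱ (ℕ.suc i) x) ℚ.- ν (Dⁱ i x)

{-# OPTIONS --safe #-}

-- Write the exponent as k + 1, so ν(x) = X := b p^(k+1). Then ν(x)/p = b p^k has valuation k,
-- so ν(D x) = X + k. Whenever ν(y) = X + m with p ∤ m, ν(y)/p = b p^k + m/p is a sum of terms of
-- valuations k and -1, so by the strict ultrametric inequality ν(D y) = ν(y) - 1 = X + (m - 1).
-- The values m = k, k - 1, …, k - (k mod p) + 1 are not multiples of p, which gives the
-- (k mod p) increments -1.

module Submission where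

open import Defs
open import Level using (Level)
open import Data.Nat as ℕ using (ℕ; NonZero; NonTrivial; suc; zero; _^_; _∸_; _%_; _≤_; _<_)
open import Data.Nat.Primality using (Prime; prime⇒nonTrivial)
open import Data.Rational as ℚ using (ℚ; mkℚ; 0ℚ; 1ℚ)
open import Data.Product using (_×_; _,_; proj₁; proj₂)
open import Relation.Nullary using (¬_)
open import Relation.Binary.PropositionalEquality as ≡ using (_≡_; _≢_)

open import Data.Nat.Divisibility using (_∣_; divides; _∣0; ∣1⇒≡1)
import Data.Nat.DivMod as ℕ
import Data.Nat.Properties as ℕ
import Data.Nat.Coprimality as Coprime
open import Data.Integer as ℤ using (+_)
import Data.Integer.Properties as ℤ
import Data.Rational.Properties as ℚ
open import Data.Rational.Solver using (module +-*-Solver)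
open import Data.Sum using (inj₁; inj₂)
open import Data.Empty using (⊥-elim)
import Algebra.Properties.Ring as RingProperties
import Relation.Binary.Reasoning.Setoid as SetoidReasoning

open +-*-Solver using (solve; _:+_; _:*_; _:-_; _:=_; con)

ℕ→ℚ≡mkℚ : ∀ n → ℕ→ℚ n ≡ mkℚ (+ n) 0 (Coprime.sym (Coprime.1-coprimeTo n))
ℕ→ℚ≡mkℚ n = ℚ.normalize-coprime (Coprime.sym (Coprime.1-coprimeTo n))

ℕ→ℚ-+ : ∀ m n → ℕ→ℚ (m ℕ.+ n) ≡ ℕ→ℚ m ℚ.+ ℕ→ℚ n
ℕ→ℚ-+ m n rewrite ℕ→ℚ≡mkℚ m | ℕ→ℚ≡mkℚ n =
  ℚ./-cong {p₁ = + (m ℕ.+ n)} (≡.sym (≡.cong₂ ℤ._+_ (ℤ.*-identityʳ (+ m)) (ℤ.*-identityʳ (+ n)))) ≡.refl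

ℕ→ℚ-* : ∀ m n → ℕ→ℚ (m ℕ.* n) ≡ ℕ→ℚ m ℚ.* ℕ→ℚ n
ℕ→ℚ-* m n rewrite ℕ→ℚ≡mkℚ m | ℕ→ℚ≡mkℚ n = ℚ./-cong {p₁ = + (m ℕ.* n)} (ℤ.pos-* m n) ≡.refl

ℕ→ℚ-≢0 : ∀ {n} → n ≢ 0 → ℕ→ℚ n ≢ 0ℚ
ℕ→ℚ-≢0 {n} n≢0 eq = n≢0 (ℤ.+-injective (≡.trans (≡.cong ℚ.↥_ (≡.sym (ℕ→ℚ≡mkℚ n))) (≡.cong ℚ.↥_ eq)))

ℕ→ℚ-nonNeg : ∀ n → 0ℚ ℚ.≤ ℕ→ℚ n
ℕ→ℚ-nonNeg n rewrite ℕ→ℚ≡mkℚ n = ℚ.nonNegative⁻¹ _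

ℕ→ℚ*1/n≡1 : ∀ n .{{_ : NonZero n}} → ℕ→ℚ n ℚ.* (+ 1 ℚ./ n) ≡ 1ℚ
ℕ→ℚ*1/n≡1 (suc n)
  rewrite ℕ→ℚ≡mkℚ (suc n) | ℚ.normalize-coprime {1} {n} (Coprime.1-coprimeTo (suc n)) =
  ℚ.*-inverseʳ (mkℚ (+ suc n) 0 (Coprime.sym (Coprime.1-coprimeTo (suc n))))

-- k ∸ k % p is the largest multiple of p that is at most k.
k∸k%p<m≤k⇒p∤m : ∀ {p k m} .{{_ : NonZero p}} → k ∸ k % p < m → m ≤ k → ¬ p ∣ m
k∸k%p<m≤k⇒p∤m {p} {k} {m} k∸k%p<m m≤k (divides c ≡.refl) =
  ℕ.<-irrefl ≡.refl (ℕ.<-≤-trans k∸k%p<m c*p≤k∸k%p)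
  where
  c≤k/p : c ≤ k ℕ./ p
  c≤k/p = ℕ.≤-trans (ℕ.≤-reflexive (≡.sym (ℕ.m*n/n≡m c p))) (ℕ./-monoˡ-≤ p m≤k)
  k/p*p≡k∸k%p : k ℕ./ p ℕ.* p ≡ k ∸ k % p
  k/p*p≡k∸k%p = ≡.trans (≡.sym (ℕ.m∸[m∸n]≡n (ℕ.m/n*n≤m k p))) (≡.cong (k ∸_) (≡.sym (ℕ.m%n≡m∸m/n*n k p)))
  c*p≤k∸k%p : c ℕ.* p ≤ k ∸ k % p
  c*p≤k∸k%p = ℕ.≤-trans (ℕ.*-monoˡ-≤ p c≤k/p) (ℕ.≤-reflexive k/p*p≡k∸k%p)

∤⇒≢0 : ∀ {p n} → ¬ p ∣ n → n ≢ 0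
∤⇒≢0 p∤0 ≡.refl = p∤0 (_ ∣0)

PadicUnit⇒≢0 : ∀ {p} b → PadicUnit p b → b ≢ 0ℚ
PadicUnit⇒≢0 _ (p∤↥b , _) ≡.refl = p∤↥b (_ ∣0)

module ValuedFieldProperties {p : ℕ} .{{_ : NonZero p}} .{{_ : NonTrivial p}} {c ℓ : Level}
                             (K : PValuedField p c ℓ) where
  open PValuedField K
  open RingProperties ring
    using (+-identityʳ-unique; +-inverseˡ-unique; +-inverseʳ-unique; -1*x≈-x; xyx⁻¹≈y; -‿involutive; -0#≈0#)

  p⁻¹ : ℚ
  p⁻¹ = + 1 ℚ./ p

  p∤1 : ¬ p ∣ 1
  p∤1 p∣1 = ℕ.nonTrivial⇒≢1 (∣1⇒≡1 p∣1)

  ι-cong : ∀ {q r} → q ≡ r → ι q ≈ ι r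
  ι-cong ≡.refl = refl

  *-≉0 : ∀ {x y} → ¬ x ≈ 0# → ¬ y ≈ 0# → ¬ (x * y) ≈ 0#
  *-≉0 {x} {y} x≉0 y≉0 xy≈0 with inverse x x≉0
  ... | x⁻¹ , xx⁻¹≈1 = y≉0 (begin
    y               ≈⟨ *-identityˡ y ⟨
    1# * y          ≈⟨ *-congʳ xx⁻¹≈1 ⟨
    (x * x⁻¹) * y   ≈⟨ *-congʳ (*-comm x x⁻¹) ⟩
    (x⁻¹ * x) * y   ≈⟨ *-assoc x⁻¹ x y ⟩
    x⁻¹ * (x * y)   ≈⟨ *-congˡ xy≈0 ⟩
    x⁻¹ * 0#        ≈⟨ zeroʳ x⁻¹ ⟩
    0#              ∎)
    where open SetoidReasoning setoid

  ι-≉0 : ∀ {q} → q ≢ 0ℚ → ¬ ι q ≈ 0#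
  ι-≉0 {q} q≢0 ιq≈0 = 1≉0 (begin
    1#                      ≈⟨ ι-1 ⟨
    ι 1ℚ                    ≈⟨ ι-cong (ℚ.*-inverseʳ q) ⟨
    ι (q ℚ.* ℚ.1/ q)        ≈⟨ ι-* q (ℚ.1/ q) ⟩
    ι q * ι (ℚ.1/ q)        ≈⟨ *-congʳ ιq≈0 ⟩
    0# * ι (ℚ.1/ q)         ≈⟨ zeroˡ _ ⟩
    0#                      ∎)
    where
    open SetoidReasoning setoid
    instance _ = ℚ.≢-nonZero q≢0

  ι-*-≉0 : ∀ {q r} → ¬ ι q ≈ 0# → ¬ ι r ≈ 0# → ¬ ι (q ℚ.* r) ≈ 0#
  ι-*-≉0 {q} {r} ιq≉0 ιr≉0 ιqr≈0 = *-≉0 ιq≉0 ιr≉0 (trans (sym (ι-* q r)) ιqr≈0)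

  ν-ι-* : ∀ {q r} → ¬ ι q ≈ 0# → ¬ ι r ≈ 0# → ν (ι (q ℚ.* r)) ≡ ν (ι q) ℚ.+ ν (ι r)
  ν-ι-* {q} {r} ιq≉0 ιr≉0 = ≡.trans (ν-cong (ι-* q r)) (ν-* (ι q) (ι r) ιq≉0 ιr≉0)

  ι-0 : ι 0ℚ ≈ 0#
  ι-0 = +-identityʳ-unique (ι 0ℚ) (ι 0ℚ) (sym (ι-+ 0ℚ 0ℚ))

  ι-neg : ∀ q → ι (ℚ.- q) ≈ - ι q
  ι-neg q = +-inverseˡ-unique (ι (ℚ.- q)) (ι q)
    (trans (sym (ι-+ (ℚ.- q) q)) (trans (ι-cong (ℚ.+-inverseˡ q)) ι-0))

  -‿≉0 : ∀ {x} → ¬ x ≈ 0# → ¬ (- x) ≈ 0#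
  -‿≉0 {x} x≉0 -x≈0 = x≉0 (trans (sym (-‿involutive x)) (trans (-‿cong -x≈0) -0#≈0#))

  ν-neg : ∀ {x} → ¬ x ≈ 0# → ν (- x) ≡ ν x
  ν-neg {x} x≉0 = begin
    ν (- x)                    ≡⟨ ν-cong -x≈ι[-1]*x ⟩
    ν (ι (ℚ.- 1ℚ) * x)         ≡⟨ ν-* _ x ι[-1]≉0 x≉0 ⟩
    ν (ι (ℚ.- 1ℚ)) ℚ.+ ν x     ≡⟨ ≡.cong (ℚ._+ ν x) (ν-unit (ℚ.- 1ℚ) (p∤1 , p∤1)) ⟩
    0ℚ ℚ.+ ν x                 ≡⟨ ℚ.+-identityˡ (ν x) ⟩
    ν x                        ∎
    where
    open ≡.≡-Reasoning
    ι[-1]≉0 : ¬ ι (ℚ.- 1ℚ) ≈ 0#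
    ι[-1]≉0 = ι-≉0 (λ ())
    -x≈ι[-1]*x : - x ≈ ι (ℚ.- 1ℚ) * x
    -x≈ι[-1]*x = trans (sym (-1*x≈-x x)) (*-congʳ (sym (trans (ι-neg 1ℚ) (-‿cong ι-1))))

  ν-+-strict : ∀ {x y} → ¬ x ≈ 0# → ¬ y ≈ 0# → ν y ℚ.< ν x →
               ¬ (x + y) ≈ 0# × ν (x + y) ≡ ν y
  ν-+-strict {x} {y} x≉0 y≉0 νy<νx = x+y≉0 , ℚ.≤-antisym νs≤νy νy≤νs
    where
    x+y≉0 : ¬ (x + y) ≈ 0#
    x+y≉0 x+y≈0 = ℚ.<-irrefl (≡.trans (ν-cong (+-inverseʳ-unique x y x+y≈0)) (ν-neg x≉0)) νy<νx
    y≈[x+y]-x : y ≈ (x + y) + - x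
    y≈[x+y]-x = sym (xyx⁻¹≈y x y)
    νy≤νs : ν y ℚ.≤ ν (x + y)
    νy≤νs = ≡.subst (ℚ._≤ ν (x + y)) (ℚ.p≥q⇒p⊓q≡q (ℚ.<⇒≤ νy<νx)) (ν-+ x y x≉0 y≉0 x+y≉0)
    νs⊓νx≤νy : ν (x + y) ℚ.⊓ ν x ℚ.≤ ν y
    νs⊓νx≤νy = ≡.subst₂ ℚ._≤_ (≡.cong (ν (x + y) ℚ.⊓_) (ν-neg x≉0)) (≡.sym (ν-cong y≈[x+y]-x))
      (ν-+ (x + y) (- x) x+y≉0 (-‿≉0 x≉0) (λ s≈0 → y≉0 (trans y≈[x+y]-x s≈0)))
    νs≤νy : ν (x + y) ℚ.≤ ν y
    νs≤νy with ℚ.≤-total (ν (x + y)) (ν x)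
    ... | inj₁ νs≤νx = ≡.subst (ℚ._≤ ν y) (ℚ.p≤q⇒p⊓q≡p νs≤νx) νs⊓νx≤νy
    ... | inj₂ νx≤νs = ⊥-elim (ℚ.<-irrefl ≡.refl
                         (ℚ.<-≤-trans νy<νx (≡.subst (ℚ._≤ ν y) (ℚ.p≥q⇒p⊓q≡q νx≤νs) νs⊓νx≤νy)))

  ι-ℕ→ℚ-≉0 : ∀ {n} → n ≢ 0 → ¬ ι (ℕ→ℚ n) ≈ 0#
  ι-ℕ→ℚ-≉0 n≢0 = ι-≉0 (ℕ→ℚ-≢0 n≢0)

  ι-p⁻¹-≉0 : ¬ ι p⁻¹ ≈ 0#
  ι-p⁻¹-≉0 = ι-≉0 p⁻¹≢0
    where
    p⁻¹≢0 : p⁻¹ ≢ 0ℚ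
    p⁻¹≢0 p⁻¹≡0 = ℚ.1≢0 (begin
      1ℚ                  ≡⟨ ℕ→ℚ*1/n≡1 p ⟨
      ℕ→ℚ p ℚ.* p⁻¹       ≡⟨ ≡.cong (ℕ→ℚ p ℚ.*_) p⁻¹≡0 ⟩
      ℕ→ℚ p ℚ.* 0ℚ        ≡⟨ ℚ.*-zeroʳ (ℕ→ℚ p) ⟩
      0ℚ                  ∎)
      where open ≡.≡-Reasoning

  ν-ι-ℕ→ℚ : ∀ {n} → ¬ p ∣ n → ν (ι (ℕ→ℚ n)) ≡ 0ℚ
  ν-ι-ℕ→ℚ {n} p∤n rewrite ℕ→ℚ≡mkℚ n = ν-unit _ (p∤n , p∤1)

  ν-ι-p⁻¹ : ν (ι p⁻¹) ≡ ℚ.- 1ℚ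
  ν-ι-p⁻¹ = begin
    ν (ι p⁻¹)                                  ≡⟨ solve 1 (λ t → t := (con 1ℚ :+ t) :- con 1ℚ) ≡.refl (ν (ι p⁻¹)) ⟩
    (1ℚ ℚ.+ ν (ι p⁻¹)) ℚ.- 1ℚ                  ≡⟨ ≡.cong (λ v → (v ℚ.+ ν (ι p⁻¹)) ℚ.- 1ℚ) ν-p ⟨
    (ν (ι (ℕ→ℚ p)) ℚ.+ ν (ι p⁻¹)) ℚ.- 1ℚ       ≡⟨ ≡.cong (ℚ._- 1ℚ) (ν-ι-* ι-p≉0 ι-p⁻¹-≉0) ⟨
    ν (ι (ℕ→ℚ p ℚ.* p⁻¹)) ℚ.- 1ℚ               ≡⟨ ≡.cong (λ q → ν (ι q) ℚ.- 1ℚ) (ℕ→ℚ*1/n≡1 p) ⟩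
    ν (ι 1ℚ) ℚ.- 1ℚ                            ≡⟨ ≡.cong (ℚ._- 1ℚ) (ν-unit 1ℚ (p∤1 , p∤1)) ⟩
    0ℚ ℚ.- 1ℚ                                  ≡⟨⟩
    ℚ.- 1ℚ                                     ∎
    where
    open ≡.≡-Reasoning
    ι-p≉0 : ¬ ι (ℕ→ℚ p) ≈ 0#
    ι-p≉0 = ι-ℕ→ℚ-≉0 (ℕ.≢-nonZero⁻¹ p)

  ι-p^n-≉0 : ∀ n → ¬ ι (ℕ→ℚ (p ^ n)) ≈ 0#
  ι-p^n-≉0 n = ι-ℕ→ℚ-≉0 (ℕ.≢-nonZero⁻¹ (p ^ n) {{ℕ.m^n≢0 p n}})

  ν-ι-p^n : ∀ n → ν (ι (ℕ→ℚ (p ^ n))) ≡ ℕ→ℚ n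
  ν-ι-p^n zero    = ν-unit 1ℚ (p∤1 , p∤1)
  ν-ι-p^n (suc n) = begin
    ν (ι (ℕ→ℚ (p ℕ.* p ^ n)))                    ≡⟨ ≡.cong (λ q → ν (ι q)) (ℕ→ℚ-* p (p ^ n)) ⟩
    ν (ι (ℕ→ℚ p ℚ.* ℕ→ℚ (p ^ n)))                ≡⟨ ν-ι-* (ι-ℕ→ℚ-≉0 (ℕ.≢-nonZero⁻¹ p)) (ι-p^n-≉0 n) ⟩
    ν (ι (ℕ→ℚ p)) ℚ.+ ν (ι (ℕ→ℚ (p ^ n)))        ≡⟨ ≡.cong₂ ℚ._+_ ν-p (ν-ι-p^n n) ⟩
    1ℚ ℚ.+ ℕ→ℚ n                                 ≡⟨ ℕ→ℚ-+ 1 n ⟨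
    ℕ→ℚ (suc n)                                  ∎
    where open ≡.≡-Reasoning

  ν-ι-unit*p^n : ∀ b → PadicUnit p b → ∀ n → ν (ι (b ℚ.* ℕ→ℚ (p ^ n))) ≡ ℕ→ℚ n
  ν-ι-unit*p^n b b-unit n = begin
    ν (ι (b ℚ.* ℕ→ℚ (p ^ n)))             ≡⟨ ν-ι-* (ι-≉0 (PadicUnit⇒≢0 b b-unit)) (ι-p^n-≉0 n) ⟩
    ν (ι b) ℚ.+ ν (ι (ℕ→ℚ (p ^ n)))       ≡⟨ ≡.cong₂ ℚ._+_ (ν-unit b b-unit) (ν-ι-p^n n) ⟩
    0ℚ ℚ.+ ℕ→ℚ n                          ≡⟨ ℚ.+-identityˡ (ℕ→ℚ n) ⟩
    ℕ→ℚ n                                 ∎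
    where open ≡.≡-Reasoning

  ι-n/p-≉0 : ∀ {n} → ¬ p ∣ n → ¬ ι (ℕ→ℚ n ℚ.* p⁻¹) ≈ 0#
  ι-n/p-≉0 {n} p∤n = ι-*-≉0 {ℕ→ℚ n} {p⁻¹} (ι-ℕ→ℚ-≉0 {n} (∤⇒≢0 p∤n)) ι-p⁻¹-≉0

  ν-ι-n/p : ∀ {n} → ¬ p ∣ n → ν (ι (ℕ→ℚ n ℚ.* p⁻¹)) ≡ ℚ.- 1ℚ
  ν-ι-n/p {n} p∤n = begin
    ν (ι (ℕ→ℚ n ℚ.* p⁻¹))            ≡⟨ ν-ι-* (ι-ℕ→ℚ-≉0 {n} (∤⇒≢0 p∤n)) ι-p⁻¹-≉0 ⟩
    ν (ι (ℕ→ℚ n)) ℚ.+ ν (ι p⁻¹)      ≡⟨ ≡.cong₂ ℚ._+_ (ν-ι-ℕ→ℚ p∤n) ν-ι-p⁻¹ ⟩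
    0ℚ ℚ.+ ℚ.- 1ℚ                    ≡⟨⟩
    ℚ.- 1ℚ                           ∎
    where open ≡.≡-Reasoning

  ν-D : ∀ {y q} → ¬ y ≈ 0# → ν y ℚ.* p⁻¹ ≡ q → ¬ ι q ≈ 0# →
        ¬ D K y ≈ 0# × ν (D K y) ≡ ν y ℚ.+ ν (ι q)
  ν-D {y} y≉0 ≡.refl ιq≉0 = *-≉0 y≉0 ιq≉0 , ν-* y _ y≉0 ιq≉0

  inc-zero : ∀ {y t} → ν (D K y) ≡ ν y ℚ.+ t → inc K y 0 ≡ t
  inc-zero {y} {t} νDy≡νy+t = ≡.trans (≡.cong (ℚ._- ν y) νDy≡νy+t)
                                      (solve 2 (λ v t → (v :+ t) :- v := t) ≡.refl (ν y) t)

  Dⁱ-suc : ∀ i y → Dⁱ K (suc i) y ≡ Dⁱ K i (D K y)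
  Dⁱ-suc zero    y = ≡.refl
  Dⁱ-suc (suc i) y = ≡.cong (D K) (Dⁱ-suc i y)

  inc-suc : ∀ y i → inc K y (suc i) ≡ inc K (D K y) i
  inc-suc y i = ≡.cong₂ (λ u v → ν u ℚ.- ν v) (Dⁱ-suc (suc i) y) (Dⁱ-suc i y)

  module Descent (b : ℚ) (b-unit : PadicUnit p b) (k : ℕ) where

    X : ℚ
    X = b ℚ.* ℕ→ℚ (p ^ suc k)

    X*p⁻¹≡b*p^k : X ℚ.* p⁻¹ ≡ b ℚ.* ℕ→ℚ (p ^ k)
    X*p⁻¹≡b*p^k = begin
      (b ℚ.* ℕ→ℚ (p ℕ.* p ^ k)) ℚ.* p⁻¹                ≡⟨ ≡.cong (λ q → (b ℚ.* q) ℚ.* p⁻¹) (ℕ→ℚ-* p (p ^ k)) ⟩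
      (b ℚ.* (ℕ→ℚ p ℚ.* ℕ→ℚ (p ^ k))) ℚ.* p⁻¹          ≡⟨ solve 4 (λ b P Q R → (b :* (P :* Q)) :* R := (b :* Q) :* (P :* R))
                                                            ≡.refl b (ℕ→ℚ p) (ℕ→ℚ (p ^ k)) p⁻¹ ⟩
      (b ℚ.* ℕ→ℚ (p ^ k)) ℚ.* (ℕ→ℚ p ℚ.* p⁻¹)          ≡⟨ ≡.cong (b ℚ.* ℕ→ℚ (p ^ k) ℚ.*_) (ℕ→ℚ*1/n≡1 p) ⟩
      (b ℚ.* ℕ→ℚ (p ^ k)) ℚ.* 1ℚ                       ≡⟨ ℚ.*-identityʳ _ ⟩
      b ℚ.* ℕ→ℚ (p ^ k)                                ∎
      where open ≡.≡-Reasoning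

    ι-b*p^k-≉0 : ¬ ι (b ℚ.* ℕ→ℚ (p ^ k)) ≈ 0#
    ι-b*p^k-≉0 = ι-*-≉0 {b} {ℕ→ℚ (p ^ k)} (ι-≉0 (PadicUnit⇒≢0 b b-unit)) (ι-p^n-≉0 k)

    ν-D-start : ∀ {y} → ¬ y ≈ 0# → ν y ≡ X → ¬ D K y ≈ 0# × ν (D K y) ≡ ν y ℚ.+ ℕ→ℚ k
    ν-D-start {y} y≉0 νy≡X = proj₁ step , ≡.trans (proj₂ step) (≡.cong (ν y ℚ.+_) (ν-ι-unit*p^n b b-unit k))
      where
      step : ¬ D K y ≈ 0# × ν (D K y) ≡ ν y ℚ.+ ν (ι (b ℚ.* ℕ→ℚ (p ^ k)))
      step = ν-D y≉0 (≡.trans (≡.cong (ℚ._* p⁻¹) νy≡X) X*p⁻¹≡b*p^k) ι-b*p^k-≉0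

    -- ν(y)/p = b p^k + n/p, and ν(n/p) = -1 < k = ν(b p^k).
    ν-D-step : ∀ {y n} → ¬ y ≈ 0# → ν y ≡ X ℚ.+ ℕ→ℚ n → ¬ p ∣ n →
               ¬ D K y ≈ 0# × ν (D K y) ≡ ν y ℚ.+ ℚ.- 1ℚ
    ν-D-step {y} {n} y≉0 νy≡X+n p∤n = proj₁ step , ≡.trans (proj₂ step) (≡.cong (ν y ℚ.+_) ν-ι-sum)
      where
      A = b ℚ.* ℕ→ℚ (p ^ k)
      B = ℕ→ℚ n ℚ.* p⁻¹
      νB<νA : ν (ι B) ℚ.< ν (ι A)
      νB<νA = ≡.subst₂ ℚ._<_ (≡.sym (ν-ι-n/p p∤n)) (≡.sym (ν-ι-unit*p^n b b-unit k))
                       (ℚ.<-≤-trans (ℚ.*<* ℤ.-<+) (ℕ→ℚ-nonNeg k))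
      strict : ¬ (ι A + ι B) ≈ 0# × ν (ι A + ι B) ≡ ν (ι B)
      strict = ν-+-strict ι-b*p^k-≉0 (ι-n/p-≉0 p∤n) νB<νA
      ι-sum-≉0 : ¬ ι (A ℚ.+ B) ≈ 0#
      ι-sum-≉0 ι-sum≈0 = proj₁ strict (trans (sym (ι-+ A B)) ι-sum≈0)
      ν-ι-sum : ν (ι (A ℚ.+ B)) ≡ ℚ.- 1ℚ
      ν-ι-sum = ≡.trans (ν-cong (ι-+ A B)) (≡.trans (proj₂ strict) (ν-ι-n/p p∤n))
      νy/p≡A+B : ν y ℚ.* p⁻¹ ≡ A ℚ.+ B
      νy/p≡A+B = ≡.trans (≡.cong (ℚ._* p⁻¹) νy≡X+n)
                   (≡.trans (ℚ.*-distribʳ-+ p⁻¹ X (ℕ→ℚ n)) (≡.cong (ℚ._+ B) X*p⁻¹≡b*p^k))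
      step : ¬ D K y ≈ 0# × ν (D K y) ≡ ν y ℚ.+ ν (ι (A ℚ.+ B))
      step = ν-D y≉0 νy/p≡A+B ι-sum-≉0

    descent : ∀ i {n y} → ¬ y ≈ 0# → ν y ≡ X ℚ.+ ℕ→ℚ (i ℕ.+ n) →
              (∀ m → n < m → m ≤ i ℕ.+ n → ¬ p ∣ m) →
              ¬ Dⁱ K i y ≈ 0# × ν (Dⁱ K i y) ≡ X ℚ.+ ℕ→ℚ n × (∀ l → l < i → inc K y l ≡ ℚ.- 1ℚ)
    descent zero    y≉0 νy≡X+n _ = y≉0 , νy≡X+n , λ _ ()
    descent (suc i) {n} {y} y≉0 νy≡X+i+1+n p∤ = proj₁ step , νDⁱ⁺¹y , inc≡-1
      where
      before : ¬ Dⁱ K i y ≈ 0# × ν (Dⁱ K i y) ≡ X ℚ.+ ℕ→ℚ (suc n) × (∀ l → l < i → inc K y l ≡ ℚ.- 1ℚ)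
      before = descent i y≉0 (≡.subst (λ m → ν y ≡ X ℚ.+ ℕ→ℚ m) (≡.sym (ℕ.+-suc i n)) νy≡X+i+1+n)
                 (λ m 1+n<m m≤i+1+n → p∤ m (ℕ.<-trans (ℕ.n<1+n n) 1+n<m) (ℕ.≤-trans m≤i+1+n (ℕ.≤-reflexive (ℕ.+-suc i n))))
      step : ¬ Dⁱ K (suc i) y ≈ 0# × ν (Dⁱ K (suc i) y) ≡ ν (Dⁱ K i y) ℚ.+ ℚ.- 1ℚ
      step = ν-D-step (proj₁ before) (proj₁ (proj₂ before)) (p∤ (suc n) (ℕ.n<1+n n) (ℕ.s≤s (ℕ.m≤n+m n i)))
      νDⁱ⁺¹y : ν (Dⁱ K (suc i) y) ≡ X ℚ.+ ℕ→ℚ n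
      νDⁱ⁺¹y = begin
        ν (Dⁱ K (suc i) y)                        ≡⟨ proj₂ step ⟩
        ν (Dⁱ K i y) ℚ.+ ℚ.- 1ℚ                   ≡⟨ ≡.cong (ℚ._+ ℚ.- 1ℚ) (proj₁ (proj₂ before)) ⟩
        (X ℚ.+ ℕ→ℚ (1 ℕ.+ n)) ℚ.+ ℚ.- 1ℚ          ≡⟨ ≡.cong (λ q → (X ℚ.+ q) ℚ.+ ℚ.- 1ℚ) (ℕ→ℚ-+ 1 n) ⟩
        (X ℚ.+ (1ℚ ℚ.+ ℕ→ℚ n)) ℚ.+ ℚ.- 1ℚ         ≡⟨ solve 2 (λ x m → (x :+ (con 1ℚ :+ m)) :- con 1ℚ := x :+ m) ≡.refl X (ℕ→ℚ n) ⟩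
        X ℚ.+ ℕ→ℚ n                               ∎
        where open ≡.≡-Reasoning
      inc≡-1 : ∀ l → l < suc i → inc K y l ≡ ℚ.- 1ℚ
      inc≡-1 l l<1+i with ℕ.m≤n⇒m<n∨m≡n (ℕ.≤-pred l<1+i)
      ... | inj₁ l<i    = proj₂ (proj₂ before) l l<i
      ... | inj₂ ≡.refl = inc-zero (proj₂ step)

proposition2p5 : ∀ {c ℓ : Level} (p : ℕ) .{{_ : NonZero p}} → Prime p →
    (K : PValuedField p c ℓ) (x : PValuedField.Carrier K) →
    ¬ (PValuedField._≈_ K x (PValuedField.0# K)) →
    (b : ℚ) → PadicUnit p b → (k : ℕ) → 1 ≤ k →
    PValuedField.ν K x ≡ b ℚ.* ℕ→ℚ (p ^ k) →
    (inc K x 0 ≡ ℕ→ℚ (k ∸ 1))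
    × (∀ (j : ℕ) → 1 ≤ j → j ≤ (k ∸ 1) % p → inc K x j ≡ ℚ.- ℚ.1ℚ)
proposition2p5 p pr K x x≉0 b b-unit zero    () νx≡X
proposition2p5 p pr K x x≉0 b b-unit (suc k) _  νx≡X = inc-zero (proj₂ start) , later
  where
  instance
    p-nonTrivial : NonTrivial p
    p-nonTrivial = prime⇒nonTrivial pr
  open PValuedField K using (ν; _≈_; 0#)
  open ValuedFieldProperties K
  open Descent b b-unit k
  r : ℕ
  r = k % p
  start : ¬ D K x ≈ 0# × ν (D K x) ≡ ν x ℚ.+ ℕ→ℚ k
  start = ν-D-start x≉0 νx≡X
  r+[k∸r]≡k : r ℕ.+ (k ∸ r) ≡ k
  r+[k∸r]≡k = ℕ.m+[n∸m]≡n (ℕ.m%n≤m k p)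
  νDx : ν (D K x) ≡ X ℚ.+ ℕ→ℚ (r ℕ.+ (k ∸ r))
  νDx = ≡.trans (proj₂ start) (≡.cong₂ ℚ._+_ νx≡X (≡.cong ℕ→ℚ (≡.sym r+[k∸r]≡k)))
  later : ∀ j → 1 ≤ j → j ≤ k % p → inc K x j ≡ ℚ.- 1ℚ
  later (suc l) _ l<r = ≡.trans (inc-suc x l) (proj₂ (proj₂ (descent r (proj₁ start) νDx p∤)) l l<r)
    where
    p∤ : ∀ m → k ∸ r < m → m ≤ r ℕ.+ (k ∸ r) → ¬ p ∣ m
    p∤ m k∸r<m m≤r+[k∸r] = k∸k%p<m≤k⇒p∤m k∸r<m (ℕ.≤-trans m≤r+[k∸r] (ℕ.≤-reflexive r+[k∸r]≡k))
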